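{- Suppose that (KCI) holds. Then the mapping $\phi\colon U\to K$ defined for all $(a_i)_{i\in I}\in P^I$ by $\phi(a_i)_{i\in I}:=(a_i)_{i\in I}$ and $\phi((\eta a_i)_{i\in I})=(\eta a_{\lambda i})_{i\in I}$ is an isomorphism of the PEA $(U;+_U,0_U,1_U)$ onto the partial algebra $(K;+,0_K,1_K)$ such that the restriction of $\phi$ to $P^I$ is the identity mapping. Therefore, $(K;+,0_K,1_K)$ is a PEA, $K$ is a kite algebra, and $\phi\colon U\to K$ is a PEA-isomorphism. Furthermore, if $\psi\colon U\to K$ is any PEA-morphism such that the restriction of $\psi$ to $P^I$ is the identity mapping, then $\psi=\phi$.
   Context: $(P;\oplus,0)$ is a GPEA (partial operation $\oplus$, constant $0$, satisfying: associativity in the sense that $a\oplus b$ and $(a\oplus b)\oplus c$ exist iff $b\oplus c$ and $a\oplus(b\oplus c)$ exist and then they are equal; if $a\oplus b$ exists there are $c,d$ with $a\oplus b=c\oplus a=b\oplus d$; two-sided cancellation; $0$ is neutral; $a\oplus b=0$ implies $a=b=0$). Order: $a\le b$ iff $a\oplus c=b$ for some $c$; for $a\le b$, $a/b$ is the unique $c$ with $a\oplus c=b$ and $b\backslash a$ is the unique $d$ with $d\oplus a=b$. $I$ is a nonempty index set, $\lambda,\rho\colon I\to I$ are bijections, $P^I$ is a GPEA under coordinatewise $\oplus$ with zero $0^I$. $P^\eta$ is a set disjoint from $P$ with a bijection $\eta\colon P\to P^\eta$; $\eta$ also denotes the coordinatewise map $P^I\to(P^\eta)^I$. $K:=P^I\cup(P^\eta)^I$,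 $0_K:=0^I$, $1_K:=(\eta 0)_{i\in I}$, and $+$ on $K$ is: (K1) $(a_i)+(b_i):=(a_i\oplus b_i)$ iff $a_i\oplus b_i$ exists for all $i$; (K2) $(a_i)+(\eta b_i):=(\eta(b_i\backslash a_{\lambda i}))$ iff $a_{\lambda i}\le b_i$ for all $i$; (K3) $(\eta a_i)+(b_i):=(\eta(b_{\rho i}/a_i))$ iff $b_{\rho i}\le a_i$ for all $i$; (K4) $(\eta a_i)+(\eta b_i)$ undefined. If $K$ is a PEA, it is called the kite algebra. Condition (KCI): for all $(a_i),(b_i)\in P^I$ and all $i\in I$, $a_{\rho i}\oplus b_i$ exists iff $b_i\oplus a_{\lambda i}$ exists. Define $\gamma(a_i)_{i\in I}:=(a_{\rho\lambda^{ -1}i})_{i\in I}$; (KCI) holds iff $\gamma$ is a unitizing GPEA-automorphism of $P^I$ (i.e. $\gamma x\oplus y$ defined iff $y\oplus x$ defined). Then $U$ is the $\gamma$-unitization of $P^I$, which as a set equals $K$, with $0_U=0_K$, $1_U=1_K$ and: (U1) $(a_i)+_U(b_i):=(a_i\oplus b_i)$ iff all $a_i\oplus b_i$ defined; (U2) $(a_i)+_U(\eta b_i):=(\eta(b_i\backslash a_i))$ iff $a_i\le b_i$ for all $i$; (U3) $(\eta a_i)+_U(b_i):=(\eta(b_{\rho\lambda^{ -1}i}/a_i))$ iff $b_{\rho\lambda^{ -1}i}\le a_i$ for all $i$; (U4) $(\eta a_i)+_U(\eta b_i)$ undefined. $U$ is a PEA (PEA = GPEA with a largest element). -}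

module Defs where

open import Level using (Level; _⊔_; Lift) renaming (suc to lsuc)
open import Data.Product using (Σ; ∃; ∃-syntax; _×_; _,_)
open import Data.Sum using (_⊎_; inj₁; inj₂)
open import Data.Empty using (⊥)
open import Relation.Binary using (Rel; IsEquivalence)
open import Function.Bundles using (_↔_; Inverse)
open import Function.Base using (_∘_)

_⇔S_ : ∀ {p q} → Set p → Set q → Set (p ⊔ q)
X ⇔S Y = (X → Y) × (Y → X)

-- Partial operations are represented relationally:
--   S a b c  means  "a ⊕ b is defined and equals c".
-- Carriers are setoids (equality _≈_), so that tuples (functions I → P)
-- can be compared pointwise without function extensionality.

module _ {c ℓ r : Level} {A : Set c} (_≈_ : Rel A ℓ) (S : A → A → A → Set r) where

  _≤ₚ_ : A → A → Set (c ⊔ r)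
  a ≤ₚ b = ∃[ x ] S a x b

  record IsGPEA (e : A) : Set (c ⊔ ℓ ⊔ r) where
    field
      isEquivalence : IsEquivalence _≈_
      S-resp    : ∀ {a a′ b b′ x x′} → a ≈ a′ → b ≈ b′ → x ≈ x′ → S a b x → S a′ b′ x′
      S-func    : ∀ {a b x x′} → S a b x → S a b x′ → x ≈ x′
      assocˡ    : ∀ {a b c d x} → S a b d → S d c x → ∃[ y ] (S b c y × S a y x)
      assocʳ    : ∀ {a b c y x} → S b c y → S a y x → ∃[ d ] (S a b d × S d c x)
      conj      : ∀ {a b x} → S a b x → (∃[ c ] S c a x) × (∃[ d ] S b d x)
      cancelˡ   : ∀ {a b b′ x} → S a b x → S a b′ x → b ≈ b′
      cancelʳ   : ∀ {a a′ b x} → S a b x → S a′ b x → a ≈ a′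
      identityˡ : ∀ {a} → S e a a
      identityʳ : ∀ {a} → S a e a
      positive  : ∀ {a b} → S a b e → (a ≈ e) × (b ≈ e)

  record IsPEA (e one : A) : Set (c ⊔ ℓ ⊔ r) where
    field
      isGPEA  : IsGPEA e
      largest : ∀ a → a ≤ₚ one

record GPEA (c ℓ r : Level) : Set (lsuc (c ⊔ ℓ ⊔ r)) where
  field
    Carrier : Set c
    _≈_     : Rel Carrier ℓ
    S       : Carrier → Carrier → Carrier → Set r
    𝟘       : Carrier
    isGPEA  : IsGPEA _≈_ S 𝟘

module _ {a ℓa r b ℓb s : Level}
         {A : Set a} (_≈A_ : Rel A ℓa) (SA : A → A → A → Set r) (eA oneA : A)
         {B : Set b} (_≈B_ : Rel B ℓb) (SB : B → B → B → Set s) (eB oneB : B) where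

  record IsPEAMorphism (f : A → B) : Set (a ⊔ ℓa ⊔ r ⊔ s ⊔ ℓb) where
    field
      cong     : ∀ {x y} → x ≈A y → f x ≈B f y
      pres-one : f oneA ≈B oneB
      pres-S   : ∀ {x y z} → SA x y z → SB (f x) (f y) (f z)

  record IsIsomorphism (f : A → B) : Set (a ⊔ ℓa ⊔ r ⊔ b ⊔ s ⊔ ℓb) where
    field
      cong      : ∀ {x y} → x ≈A y → f x ≈B f y
      injective : ∀ {x y} → f x ≈B f y → x ≈A y
      surjective : ∀ y → ∃[ x ] (f x ≈B y)
      pres-zero : f eA ≈B eB
      pres-one  : f oneA ≈B oneB
      pres-S    : ∀ {x y z} → SA x y z ⇔S SB (f x) (f y) (f z)

-- The kite construction.
-- P^η is represented by a second copy of P^I: K = P^I ⊎ (P^η)^I where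
-- inj₂ a  stands for  (η a_i)_{i∈I}.

module Kite {c ℓ r ι : Level} (P : GPEA c ℓ r) (I : Set ι) (lam rho : I ↔ I) where
  open GPEA P

  λ′ ρ′ λ⁻¹ : I → I
  λ′  = Inverse.to lam
  ρ′  = Inverse.to rho
  λ⁻¹ = Inverse.from lam

  PI : Set (ι ⊔ c)
  PI = I → Carrier

  K : Set (ι ⊔ c)
  K = PI ⊎ PI

  _≈K_ : K → K → Set (ι ⊔ ℓ)
  inj₁ a ≈K inj₁ b = ∀ i → a i ≈ b i
  inj₂ a ≈K inj₂ b = ∀ i → a i ≈ b i
  _      ≈K _      = Lift (ι ⊔ ℓ) ⊥

  0K 1K : K
  0K = inj₁ (λ _ → 𝟘)
  1K = inj₂ (λ _ → 𝟘)

  -- the partial operation + on K:  KSum x y z  means  x + y is defined and equals z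
  --  (K1) (a_i)+(b_i) = (a_i ⊕ b_i)
  --  (K2) (a_i)+(η b_i) = (η(b_i \ a_{λi})),   i.e.  c_i ⊕ a_{λi} = b_i
  --  (K3) (η a_i)+(b_i) = (η(b_{ρi} / a_i)),    i.e.  b_{ρi} ⊕ c_i = a_i
  --  (K4) (η a_i)+(η b_i) undefined
  KSum : K → K → K → Set (ι ⊔ r)
  KSum (inj₁ a) (inj₁ b) (inj₁ x) = ∀ i → S (a i) (b i) (x i)
  KSum (inj₁ a) (inj₂ b) (inj₂ x) = ∀ i → S (x i) (a (λ′ i)) (b i)
  KSum (inj₂ a) (inj₁ b) (inj₂ x) = ∀ i → S (b (ρ′ i)) (x i) (a i)
  KSum _        _        _        = Lift (ι ⊔ r) ⊥

  -- the γ-unitization U of P^I, γ(a_i) = (a_{ρλ⁻¹i}); same carrier and equality as K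
  --  (U1) (a_i)+(b_i) = (a_i ⊕ b_i)
  --  (U2) (a_i)+(η b_i) = (η(b_i \ a_i))
  --  (U3) (η a_i)+(b_i) = (η(b_{ρλ⁻¹i} / a_i))
  --  (U4) undefined
  USum : K → K → K → Set (ι ⊔ r)
  USum (inj₁ a) (inj₁ b) (inj₁ x) = ∀ i → S (a i) (b i) (x i)
  USum (inj₁ a) (inj₂ b) (inj₂ x) = ∀ i → S (x i) (a i) (b i)
  USum (inj₂ a) (inj₁ b) (inj₂ x) = ∀ i → S (b (ρ′ (λ⁻¹ i))) (x i) (a i)
  USum _        _        _        = Lift (ι ⊔ r) ⊥

  0U 1U : K
  0U = 0K
  1U = 1K

  KCI : Set (ι ⊔ c ⊔ r)
  KCI = ∀ (a b : PI) (i : I) →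
          (∃[ x ] S (a (ρ′ i)) (b i) x) ⇔S (∃[ y ] S (b i) (a (λ′ i)) y)

  φ : K → K
  φ (inj₁ a) = inj₁ a
  φ (inj₂ a) = inj₂ (λ i → a (λ′ i))

-- The power P^I of a GPEA is a GPEA
-- (coordinatewise), and reindexing along a permutation of I is a GPEA
-- automorphism of P^I.  For γ(a)_i = a_{ρλ⁻¹i}, condition (KCI) says exactly
-- that γ is *unitizing*.  The γ-unitization of any GPEA along a unitizing
-- automorphism is a PEA (Unitization.isPEA).  The map φ is an isomorphism of
-- partial algebras from that unitization onto (K; +, 0_K, 1_K); since a
-- partial algebra isomorphic to a PEA is itself a PEA (transport-isPEA), K is
-- a PEA, i.e. the kite algebra exists.  Finally, two PEA-morphisms preserving
-- 1 that agree on a also agree on every b with a ⊕ b = 1 (cancellation in the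
-- target); since (a_i) + (η a_i) = 1 in U, a morphism ψ : U → K fixing P^I
-- agrees with φ everywhere.

module Submission where

open import Defs
open import Level using (Level; _⊔_; lift)
open import Data.Product using (_×_; _,_; proj₁; proj₂; ∃; ∃-syntax)
open import Data.Sum using (_⊎_; inj₁; inj₂)
open import Data.Sum.Relation.Binary.Pointwise using (Pointwise; inj₁; inj₂; ⊎-isEquivalence)
open import Function.Base using (_∘_)
open import Function.Bundles using (_↔_; Inverse)
open import Function.Construct.Composition using (_↔-∘_)
open import Function.Construct.Symmetry using (↔-sym)
open import Relation.Binary using (Rel; IsEquivalence)
import Relation.Binary.PropositionalEquality as ≡
open ≡ using (_≡_; subst)

choice : ∀ {ι a q} {I : Set ι} {A : Set a} {Q : I → A → Set q} →
         (∀ i → ∃[ y ] Q i y) → ∃[ f ] (∀ i → Q i (f i))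
choice h = (λ i → proj₁ (h i)) , (λ i → proj₂ (h i))

choice× : ∀ {ι a q q′} {I : Set ι} {A : Set a} {Q : I → A → Set q} {Q′ : I → A → Set q′} →
          (∀ i → ∃[ y ] (Q i y × Q′ i y)) → ∃[ f ] ((∀ i → Q i (f i)) × (∀ i → Q′ i (f i)))
choice× h = (λ i → proj₁ (h i)) , (λ i → proj₁ (proj₂ (h i))) , (λ i → proj₂ (proj₂ (h i)))

along : ∀ {ι q} {I : Set ι} (τ : I ↔ I) {Q : I → Set q} → (∀ j → Q (Inverse.to τ j)) → ∀ i → Q i
along τ {Q} h i = subst Q (Inverse.strictlyInverseˡ τ i) (h (Inverse.from τ i))

module _ {c ℓ r : Level} (E : GPEA c ℓ r) where
  open GPEA E

  record IsAutomorphism (γ : Carrier → Carrier) : Set (c ⊔ ℓ ⊔ r) where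
    field
      cong       : ∀ {x y} → x ≈ y → γ x ≈ γ y
      injective  : ∀ {x y} → γ x ≈ γ y → x ≈ y
      surjective : ∀ y → ∃[ x ] (γ x ≈ y)
      pres-S     : ∀ {a b x} → S a b x ⇔S S (γ a) (γ b) (γ x)

  Unitizing : (Carrier → Carrier) → Set (c ⊔ r)
  Unitizing γ = ∀ x y → (∃[ z ] S (γ x) y z) ⇔S (∃[ z ] S y x z)

-- Carrier E ⊎ E, where inj₂ a stands for η a, with
--   (U1) a + b = a ⊕ b,  (U2) a + η b = η (b \ a),  (U3) η a + b = η (γb / a).

module Unitization {c ℓ r : Level} (E : GPEA c ℓ r) (γ : GPEA.Carrier E → GPEA.Carrier E)
                   (γ-aut : IsAutomorphism E γ) (γ-unit : Unitizing E γ) where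
  open GPEA E
  open IsGPEA isGPEA
  open IsEquivalence isEquivalence using (refl; sym)
  private module γ = IsAutomorphism γ-aut

  U : Set c
  U = Carrier ⊎ Carrier

  _≈U_ : Rel U (c ⊔ ℓ)
  _≈U_ = Pointwise _≈_ _≈_

  data Sum : U → U → U → Set (c ⊔ r) where
    U1 : ∀ {a b x} → S a b x     → Sum (inj₁ a) (inj₁ b) (inj₁ x)
    U2 : ∀ {a b x} → S x a b     → Sum (inj₁ a) (inj₂ b) (inj₂ x)
    U3 : ∀ {a b x} → S (γ b) x a → Sum (inj₂ a) (inj₁ b) (inj₂ x)

  0ᵤ 1ᵤ : U
  0ᵤ = inj₁ 𝟘
  1ᵤ = inj₂ 𝟘

  -- an automorphism fixes 0, since γ0 ⊕ γ0 = γ0 = 0 ⊕ γ0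
  γ-zero : γ 𝟘 ≈ 𝟘
  γ-zero = cancelʳ (proj₁ γ.pres-S (identityˡ {𝟘})) identityˡ

  γ-reflect : ∀ {a b e} → S (γ a) (γ b) e → ∃[ y ] (S a b y × γ y ≈ e)
  γ-reflect s with γ.surjective _
  ... | y , γy≈e = y , proj₂ γ.pres-S (S-resp refl refl (sym γy≈e) s) , γy≈e

  Sum-resp : ∀ {a a′ b b′ x x′} → a ≈U a′ → b ≈U b′ → x ≈U x′ → Sum a b x → Sum a′ b′ x′
  Sum-resp (inj₁ ea) (inj₁ eb) (inj₁ ex) (U1 s) = U1 (S-resp ea eb ex s)
  Sum-resp (inj₁ ea) (inj₂ eb) (inj₂ ex) (U2 s) = U2 (S-resp ex ea eb s)
  Sum-resp (inj₂ ea) (inj₁ eb) (inj₂ ex) (U3 s) = U3 (S-resp (γ.cong eb) ex ea s)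

  Sum-func : ∀ {a b x x′} → Sum a b x → Sum a b x′ → x ≈U x′
  Sum-func (U1 s) (U1 t) = inj₁ (S-func s t)
  Sum-func (U2 s) (U2 t) = inj₂ (cancelʳ s t)
  Sum-func (U3 s) (U3 t) = inj₂ (cancelˡ s t)

  Sum-cancelˡ : ∀ {a b b′ x} → Sum a b x → Sum a b′ x → b ≈U b′
  Sum-cancelˡ (U1 s) (U1 t) = inj₁ (cancelˡ s t)
  Sum-cancelˡ (U2 s) (U2 t) = inj₂ (S-func s t)
  Sum-cancelˡ (U3 s) (U3 t) = inj₁ (γ.injective (cancelʳ s t))

  Sum-cancelʳ : ∀ {a a′ b x} → Sum a b x → Sum a′ b x → a ≈U a′
  Sum-cancelʳ (U1 s) (U1 t) = inj₁ (cancelʳ s t)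
  Sum-cancelʳ (U2 s) (U2 t) = inj₁ (cancelˡ s t)
  Sum-cancelʳ (U3 s) (U3 t) = inj₂ (S-func s t)

  -- the two existence clauses for η-elements are where γ being unitizing
  -- (and surjective) is needed
  Sum-conj : ∀ {a b x} → Sum a b x → (∃[ c ] Sum c a x) × (∃[ d ] Sum b d x)
  Sum-conj (U1 s) with conj s
  ... | (c , sc) , (d , sd) = (inj₁ c , U1 sc) , (inj₁ d , U1 sd)
  Sum-conj {inj₁ a} {x = inj₂ x} (U2 s) with conj s
  ... | (c , sc) , _ with γ.surjective c
  ...   | d , γd≈c =
    (inj₂ _ , U3 (proj₂ (proj₂ (γ-unit a x) (_ , s)))) , (inj₁ d , U3 (S-resp (sym γd≈c) refl refl sc))
  Sum-conj {b = inj₁ b} {inj₂ x} (U3 s) =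
    (inj₁ _ , U2 (proj₂ (proj₂ (conj s)))) , (inj₂ _ , U2 (proj₂ (proj₁ (γ-unit b x) (_ , s))))

  Sum-assocˡ : ∀ {a b c d x} → Sum a b d → Sum d c x → ∃[ y ] (Sum b c y × Sum a y x)
  Sum-assocˡ (U1 s) (U1 t) with assocˡ s t
  ... | y , sy , ty = inj₁ y , U1 sy , U1 ty
  Sum-assocˡ (U1 s) (U2 t) with assocʳ s t
  ... | y , sy , ty = inj₂ y , U2 ty , U2 sy
  Sum-assocˡ (U2 s) (U3 t) with assocˡ t s
  ... | y , sy , ty = inj₂ y , U3 ty , U2 sy
  Sum-assocˡ (U3 s) (U3 t) with assocʳ t s
  ... | e , se , te with γ-reflect se
  ...   | y , sy , γy≈e = inj₁ y , U1 sy , U3 (S-resp (sym γy≈e) refl refl te)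

  Sum-assocʳ : ∀ {a b c y x} → Sum b c y → Sum a y x → ∃[ d ] (Sum a b d × Sum d c x)
  Sum-assocʳ (U1 s) (U1 t) with assocʳ s t
  ... | d , sd , td = inj₁ d , U1 sd , U1 td
  Sum-assocʳ (U2 s) (U2 t) with assocˡ t s
  ... | d , sd , td = inj₁ d , U1 sd , U2 td
  Sum-assocʳ (U1 s) (U3 t) with assocˡ (proj₁ γ.pres-S s) t
  ... | d , sd , td = inj₂ d , U3 td , U3 sd
  Sum-assocʳ (U3 s) (U2 t) with assocʳ t s
  ... | d , sd , td = inj₂ d , U2 td , U3 sd

  Sum-identityˡ : ∀ {a} → Sum 0ᵤ a a
  Sum-identityˡ {inj₁ _} = U1 identityˡ
  Sum-identityˡ {inj₂ _} = U2 identityʳ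

  Sum-identityʳ : ∀ {a} → Sum a 0ᵤ a
  Sum-identityʳ {inj₁ _} = U1 identityʳ
  Sum-identityʳ {inj₂ _} = U3 (S-resp (sym γ-zero) refl refl identityˡ)

  Sum-positive : ∀ {a b} → Sum a b 0ᵤ → (a ≈U 0ᵤ) × (b ≈U 0ᵤ)
  Sum-positive (U1 s) with positive s
  ... | a≈0 , b≈0 = inj₁ a≈0 , inj₁ b≈0

  -- a + η a = 1 and η a + γ⁻¹ a = 1
  Sum-largest : ∀ a → ∃[ x ] Sum a x 1ᵤ
  Sum-largest (inj₁ a) = inj₂ a , U2 identityˡ
  Sum-largest (inj₂ a) with γ.surjective a
  ... | b , γb≈a = inj₁ b , U3 (S-resp refl refl γb≈a identityʳ)

  isPEA : IsPEA _≈U_ Sum 0ᵤ 1ᵤ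
  isPEA = record
    { isGPEA = record
      { isEquivalence = ⊎-isEquivalence isEquivalence isEquivalence
      ; S-resp = Sum-resp
      ; S-func = Sum-func
      ; assocˡ = Sum-assocˡ
      ; assocʳ = Sum-assocʳ
      ; conj = Sum-conj
      ; cancelˡ = Sum-cancelˡ
      ; cancelʳ = Sum-cancelʳ
      ; identityˡ = Sum-identityˡ
      ; identityʳ = Sum-identityʳ
      ; positive = Sum-positive
      }
    ; largest = Sum-largest
    }

-- Every element of B is ≈ f of a chosen preimage; hypotheses about sums in B
-- are pulled back to A, the axioms of A are applied, and the conclusions are
-- pushed forward again.  B must already be a setoid on which ⊕ is well defined.

module _ {a ℓa r b ℓb s : Level}
         {A : Set a} {_≈A_ : Rel A ℓa} {SA : A → A → A → Set r} {eA oneA : A}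
         {B : Set b} {_≈B_ : Rel B ℓb} {SB : B → B → B → Set s} {eB oneB : B}
         (A-isPEA : IsPEA _≈A_ SA eA oneA)
         (B-isEquivalence : IsEquivalence _≈B_)
         (SB-resp : ∀ {x x′ y y′ z z′} → x ≈B x′ → y ≈B y′ → z ≈B z′ → SB x y z → SB x′ y′ z′)
         {f : A → B} (f-iso : IsIsomorphism _≈A_ SA eA oneA _≈B_ SB eB oneB f) where
  open IsPEA A-isPEA
  open IsGPEA isGPEA
  open IsEquivalence isEquivalence using () renaming (refl to reflA)
  open IsEquivalence B-isEquivalence using () renaming (refl to reflB; sym to symB; trans to transB)
  private module f = IsIsomorphism f-iso

  pre : B → A
  pre y = proj₁ (f.surjective y)

  f-pre : ∀ y → f (pre y) ≈B y
  f-pre y = proj₂ (f.surjective y)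

  pull : ∀ {x y z} → SB x y z → SA (pre x) (pre y) (pre z)
  pull s = proj₂ f.pres-S (SB-resp (symB (f-pre _)) (symB (f-pre _)) (symB (f-pre _)) s)

  push : ∀ {x y z} → SA x y z → SB (f x) (f y) (f z)
  push = proj₁ f.pres-S

  pull-≈ : ∀ {x y} → pre x ≈A pre y → x ≈B y
  pull-≈ e = transB (symB (f-pre _)) (transB (f.cong e) (f-pre _))

  transport-isPEA : IsPEA _≈B_ SB eB oneB
  transport-isPEA = record
    { isGPEA = record
      { isEquivalence = B-isEquivalence
      ; S-resp = SB-resp
      ; S-func = λ s t → pull-≈ (S-func (pull s) (pull t))
      ; assocˡ = λ s t → let (y , sy , ty) = assocˡ (pull s) (pull t)
                         in f y , SB-resp (f-pre _) (f-pre _) reflB (push sy)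
                                , SB-resp (f-pre _) reflB (f-pre _) (push ty)
      ; assocʳ = λ s t → let (d , sd , td) = assocʳ (pull s) (pull t)
                         in f d , SB-resp (f-pre _) (f-pre _) reflB (push sd)
                                , SB-resp reflB (f-pre _) (f-pre _) (push td)
      ; conj = λ s → let ((x , sx) , (y , sy)) = conj (pull s)
                     in (f x , SB-resp reflB (f-pre _) (f-pre _) (push sx))
                      , (f y , SB-resp (f-pre _) reflB (f-pre _) (push sy))
      ; cancelˡ = λ s t → pull-≈ (cancelˡ (pull s) (pull t))
      ; cancelʳ = λ s t → pull-≈ (cancelʳ (pull s) (pull t))
      ; identityˡ = SB-resp f.pres-zero (f-pre _) (f-pre _) (push identityˡ)
      ; identityʳ = SB-resp (f-pre _) f.pres-zero (f-pre _) (push identityʳ)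
      ; positive = λ s → let (x≈0 , y≈0) = positive (pre-zero (pull s))
                         in zero-image x≈0 , zero-image y≈0
      }
    ; largest = λ x → let (y , sy) = largest (pre x)
                      in f y , SB-resp (f-pre x) reflB f.pres-one (push sy)
    }
    where
    pre-zero : ∀ {x y} → SA x y (pre eB) → SA x y eA
    pre-zero = S-resp reflA reflA (f.injective (transB (f-pre eB) (symB f.pres-zero)))

    zero-image : ∀ {y} → pre y ≈A eA → y ≈B eB
    zero-image e = transB (symB (f-pre _)) (transB (f.cong e) f.pres-zero)

-- PEA-morphisms into a GPEA that agree on a agree on each complement of a:
-- from a ⊕ b = 1 we get f a ⊕ f b = 1 = g a ⊕ g b, and f a = g a cancels.

module _ {a ℓa r b ℓb s : Level}
         {A : Set a} {_≈A_ : Rel A ℓa} {SA : A → A → A → Set r} {eA oneA : A}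
         {B : Set b} {_≈B_ : Rel B ℓb} {SB : B → B → B → Set s} {eB oneB : B}
         (B-isGPEA : IsGPEA _≈B_ SB eB) {f g : A → B}
         (f-mor : IsPEAMorphism _≈A_ SA eA oneA _≈B_ SB eB oneB f)
         (g-mor : IsPEAMorphism _≈A_ SA eA oneA _≈B_ SB eB oneB g) where
  open IsGPEA B-isGPEA
  open IsEquivalence isEquivalence using (refl)
  private
    module f = IsPEAMorphism f-mor
    module g = IsPEAMorphism g-mor

  agree-on-complement : ∀ {x y} → SA x y oneA → f x ≈B g x → f y ≈B g y
  agree-on-complement s fx≈gx =
    cancelˡ (S-resp fx≈gx refl f.pres-one (f.pres-S s)) (S-resp refl refl g.pres-one (g.pres-S s))

module Power {c ℓ r ι : Level} (P : GPEA c ℓ r) (I : Set ι) where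
  open GPEA P
  open IsGPEA isGPEA
  open IsEquivalence isEquivalence using (refl; sym; trans; reflexive)

  _≈ᴵ_ : Rel (I → Carrier) (ι ⊔ ℓ)
  a ≈ᴵ b = ∀ i → a i ≈ b i

  Sᴵ : (I → Carrier) → (I → Carrier) → (I → Carrier) → Set (ι ⊔ r)
  Sᴵ a b x = ∀ i → S (a i) (b i) (x i)

  Pᴵ : GPEA (ι ⊔ c) (ι ⊔ ℓ) (ι ⊔ r)
  Pᴵ = record
    { Carrier = I → Carrier
    ; _≈_ = _≈ᴵ_
    ; S = Sᴵ
    ; 𝟘 = λ _ → 𝟘
    ; isGPEA = record
      { isEquivalence = record
        { refl = λ _ → refl ; sym = λ e i → sym (e i) ; trans = λ e e′ i → trans (e i) (e′ i) }
      ; S-resp = λ ea eb ex s i → S-resp (ea i) (eb i) (ex i) (s i)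
      ; S-func = λ s t i → S-func (s i) (t i)
      ; assocˡ = λ s t → choice× (λ i → assocˡ (s i) (t i))
      ; assocʳ = λ s t → choice× (λ i → assocʳ (s i) (t i))
      ; conj = λ s → choice (λ i → proj₁ (conj (s i))) , choice (λ i → proj₂ (conj (s i)))
      ; cancelˡ = λ s t i → cancelˡ (s i) (t i)
      ; cancelʳ = λ s t i → cancelʳ (s i) (t i)
      ; identityˡ = λ _ → identityˡ
      ; identityʳ = λ _ → identityʳ
      ; positive = λ s → (λ i → proj₁ (positive (s i))) , (λ i → proj₂ (positive (s i)))
      }
    }

  permute : I ↔ I → (I → Carrier) → (I → Carrier)
  permute τ a = a ∘ Inverse.to τ

  permute-isAutomorphism : (τ : I ↔ I) → IsAutomorphism Pᴵ (permute τ)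
  permute-isAutomorphism τ = record
    { cong = λ e → e ∘ Inverse.to τ
    ; injective = along τ
    ; surjective = λ a → a ∘ Inverse.from τ , λ i → reflexive (≡.cong a (Inverse.strictlyInverseʳ τ i))
    ; pres-S = (λ s → s ∘ Inverse.to τ) , along τ
    }

module KiteIsomorphism {c ℓ r ι : Level} (P : GPEA c ℓ r) (I : Set ι) (lam rho : I ↔ I)
                       (kci : Kite.KCI P I lam rho) where
  open GPEA P
  open IsGPEA isGPEA using (isEquivalence; S-resp; identityˡ)
  open IsEquivalence isEquivalence using (refl; reflexive)
  open Kite P I lam rho
  open Power P I

  λ⁻¹∘λ : ∀ i → λ⁻¹ (λ′ i) ≡ i
  λ⁻¹∘λ = Inverse.strictlyInverseʳ lam

  ρλ⁻¹ : I ↔ I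
  ρλ⁻¹ = rho ↔-∘ ↔-sym lam

  γ : PI → PI
  γ = permute ρλ⁻¹

  -- (KCI) at index λ⁻¹ i, applied to b ∘ λ, is unitizing at coordinate i
  γ-unitizing : Unitizing Pᴵ γ
  γ-unitizing a b = (λ (_ , s) → choice (λ i → proj₁ (at i) (_ , s i)))
                  , (λ (_ , s) → choice (λ i → proj₂ (at i) (_ , s i)))
    where
    at : ∀ i → (∃[ z ] S (γ a i) (b i) z) ⇔S (∃[ z ] S (b i) (a i) z)
    at i = subst (λ k → (∃[ z ] S (γ a i) (b k) z) ⇔S (∃[ z ] S (b k) (a k) z))
                 (Inverse.strictlyInverseˡ lam i) (kci a (b ∘ λ′) (λ⁻¹ i))

  module Uγ = Unitization Pᴵ γ (permute-isAutomorphism ρλ⁻¹) γ-unitizing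
  open Uγ using (_≈U_; U1; U2; U3)

  ≈K⇒≈U : ∀ {x y} → x ≈K y → x ≈U y
  ≈K⇒≈U {inj₁ _} {inj₁ _} e = inj₁ e
  ≈K⇒≈U {inj₂ _} {inj₂ _} e = inj₂ e
  ≈K⇒≈U {inj₁ _} {inj₂ _} (lift ())
  ≈K⇒≈U {inj₂ _} {inj₁ _} (lift ())

  ≈U⇒≈K : ∀ {x y} → x ≈U y → x ≈K y
  ≈U⇒≈K (inj₁ e) = e
  ≈U⇒≈K (inj₂ e) = e

  ≈K-isEquivalence : IsEquivalence _≈K_
  ≈K-isEquivalence = record
    { refl = ≈U⇒≈K U.refl
    ; sym = λ e → ≈U⇒≈K (U.sym (≈K⇒≈U e))
    ; trans = λ e e′ → ≈U⇒≈K (U.trans (≈K⇒≈U e) (≈K⇒≈U e′))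
    }
    where module U = IsEquivalence (IsGPEA.isEquivalence (IsPEA.isGPEA Uγ.isPEA))

  KSum-resp : ∀ {a a′ b b′ x x′} → a ≈K a′ → b ≈K b′ → x ≈K x′ → KSum a b x → KSum a′ b′ x′
  KSum-resp ea eb ex = resp (≈K⇒≈U ea) (≈K⇒≈U eb) (≈K⇒≈U ex)
    where
    resp : ∀ {a a′ b b′ x x′} → a ≈U a′ → b ≈U b′ → x ≈U x′ → KSum a b x → KSum a′ b′ x′
    resp (inj₁ ea) (inj₁ eb) (inj₁ ex) s = λ i → S-resp (ea i) (eb i) (ex i) (s i)
    resp (inj₁ ea) (inj₂ eb) (inj₂ ex) s = λ i → S-resp (ex i) (ea (λ′ i)) (eb i) (s i)
    resp (inj₂ ea) (inj₁ eb) (inj₂ ex) s = λ i → S-resp (eb (ρ′ i)) (ex i) (ea i) (s i)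
    resp (inj₁ _) (inj₁ _) (inj₂ _) (lift ())
    resp (inj₁ _) (inj₂ _) (inj₁ _) (lift ())
    resp (inj₂ _) (inj₁ _) (inj₁ _) (lift ())
    resp (inj₂ _) (inj₂ _) _ (lift ())

  USum⇒Sum : ∀ {x y z} → USum x y z → Uγ.Sum x y z
  USum⇒Sum {inj₁ _} {inj₁ _} {inj₁ _} s = U1 s
  USum⇒Sum {inj₁ _} {inj₂ _} {inj₂ _} s = U2 s
  USum⇒Sum {inj₂ _} {inj₁ _} {inj₂ _} s = U3 s
  USum⇒Sum {inj₁ _} {inj₁ _} {inj₂ _} (lift ())
  USum⇒Sum {inj₁ _} {inj₂ _} {inj₁ _} (lift ())
  USum⇒Sum {inj₂ _} {inj₁ _} {inj₁ _} (lift ())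
  USum⇒Sum {inj₂ _} {inj₂ _} {_} (lift ())

  Sum⇒USum : ∀ {x y z} → Uγ.Sum x y z → USum x y z
  Sum⇒USum (U1 s) = s
  Sum⇒USum (U2 s) = s
  Sum⇒USum (U3 s) = s

  φ-cong : ∀ {x y} → x ≈U y → φ x ≈K φ y
  φ-cong (inj₁ e) = e
  φ-cong (inj₂ e) = e ∘ λ′

  φ-injective : ∀ {x y} → φ x ≈K φ y → x ≈U y
  φ-injective {inj₁ _} {inj₁ _} e = inj₁ e
  φ-injective {inj₂ _} {inj₂ _} e = inj₂ (along lam e)
  φ-injective {inj₁ _} {inj₂ _} (lift ())
  φ-injective {inj₂ _} {inj₁ _} (lift ())

  φ-surjective : ∀ y → ∃[ x ] (φ x ≈K y)
  φ-surjective (inj₁ y) = inj₁ y , λ _ → refl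
  φ-surjective (inj₂ y) = inj₂ (y ∘ λ⁻¹) , λ i → reflexive (≡.cong y (λ⁻¹∘λ i))

  -- (U2)/(U3) at coordinate λ i are (K2)/(K3) at coordinate i
  φ-pres-Sum : ∀ {x y z} → Uγ.Sum x y z → KSum (φ x) (φ y) (φ z)
  φ-pres-Sum (U1 s) = s
  φ-pres-Sum (U2 s) = s ∘ λ′
  φ-pres-Sum {y = inj₁ b} (U3 s) = λ i → S-resp (reflexive (≡.cong (b ∘ ρ′) (λ⁻¹∘λ i))) refl refl (s (λ′ i))

  φ-reflect-Sum : ∀ {x y z} → KSum (φ x) (φ y) (φ z) → Uγ.Sum x y z
  φ-reflect-Sum {inj₁ _} {inj₁ _} {inj₁ _} s = U1 s
  φ-reflect-Sum {inj₁ _} {inj₂ _} {inj₂ _} s = U2 (along lam s)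
  φ-reflect-Sum {inj₂ _} {inj₁ b} {inj₂ _} s =
    U3 (along lam (λ i → S-resp (reflexive (≡.cong (b ∘ ρ′) (≡.sym (λ⁻¹∘λ i)))) refl refl (s i)))
  φ-reflect-Sum {inj₁ _} {inj₁ _} {inj₂ _} (lift ())
  φ-reflect-Sum {inj₁ _} {inj₂ _} {inj₁ _} (lift ())
  φ-reflect-Sum {inj₂ _} {inj₁ _} {inj₁ _} (lift ())
  φ-reflect-Sum {inj₂ _} {inj₂ _} {_} (lift ())

  φ-iso-unitization : IsIsomorphism _≈U_ Uγ.Sum Uγ.0ᵤ Uγ.1ᵤ _≈K_ KSum 0K 1K φ
  φ-iso-unitization = record
    { cong = φ-cong ; injective = φ-injective ; surjective = φ-surjective
    ; pres-zero = λ _ → refl ; pres-one = λ _ → refl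
    ; pres-S = φ-pres-Sum , φ-reflect-Sum
    }

  φ-iso : IsIsomorphism _≈K_ USum 0U 1U _≈K_ KSum 0K 1K φ
  φ-iso = record
    { cong = φ-cong ∘ ≈K⇒≈U ; injective = ≈U⇒≈K ∘ φ-injective ; surjective = φ-surjective
    ; pres-zero = λ _ → refl ; pres-one = λ _ → refl
    ; pres-S = φ-pres-Sum ∘ USum⇒Sum , Sum⇒USum ∘ φ-reflect-Sum
    }

  φ-fixes-PI : ∀ a → φ (inj₁ a) ≈K inj₁ a
  φ-fixes-PI a _ = refl

  K-isPEA : IsPEA _≈K_ KSum 0K 1K
  K-isPEA = transport-isPEA Uγ.isPEA ≈K-isEquivalence KSum-resp φ-iso-unitization

  φ-morphism : IsPEAMorphism _≈K_ USum 0U 1U _≈K_ KSum 0K 1K φ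
  φ-morphism = record
    { cong = IsIsomorphism.cong φ-iso ; pres-one = IsIsomorphism.pres-one φ-iso
    ; pres-S = proj₁ (IsIsomorphism.pres-S φ-iso) }

  -- a morphism fixing P^I agrees with φ on η a, the complement of a in U
  φ-unique : ∀ (ψ : K → K) → IsPEAMorphism _≈K_ USum 0U 1U _≈K_ KSum 0K 1K ψ →
             (∀ a → ψ (inj₁ a) ≈K inj₁ a) → ∀ x → ψ x ≈K φ x
  φ-unique _ _ ψ-fixes (inj₁ a) = ψ-fixes a
  φ-unique ψ ψ-mor ψ-fixes (inj₂ a) =
    agree-on-complement (IsPEA.isGPEA K-isPEA) ψ-mor φ-morphism
                        {inj₁ a} {inj₂ a} (λ _ → identityˡ) (ψ-fixes a)

theorem3p9 : ∀ {c ℓ r ι : Level} (P : GPEA c ℓ r) (I : Set ι) → I → (lam rho : I ↔ I) →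
    Kite.KCI P I lam rho →
    let open Kite P I lam rho in
      IsIsomorphism _≈K_ USum 0U 1U _≈K_ KSum 0K 1K φ
      × (∀ a → φ (inj₁ a) ≈K inj₁ a)
      × IsPEA _≈K_ KSum 0K 1K
      × IsPEAMorphism _≈K_ USum 0U 1U _≈K_ KSum 0K 1K φ
      × (∀ (ψ : K → K) → IsPEAMorphism _≈K_ USum 0U 1U _≈K_ KSum 0K 1K ψ →
           (∀ a → ψ (inj₁ a) ≈K inj₁ a) → ∀ x → ψ x ≈K φ x)
theorem3p9 P I _ lam rho kci = φ-iso , φ-fixes-PI , K-isPEA , φ-morphism , φ-unique
  where open KiteIsomorphism P I lam rho kci
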